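{- Let $n \ge 1$ and let $\lambda = \mathbf{2 \times n}$ be the rectangular Young diagram with $2$ rows and $n$ columns. Then the matrix $K_{\lambda}$ has full rank (equivalently, its rows are linearly independent).
   Context: Let $\lambda$ be a partition of $N$. A tableau of shape $\lambda$ is a filling of the Young diagram of $\lambda$ with the numbers $1,\dots,N$, each used once. Two tableaux are $h$-equivalent if one can be obtained from the other by permuting entries within rows and permuting rows of equal length; a horizontal tableau is an $h$-equivalence class, so its rows form a set partition of $\{1,\dots,N\}$ into blocks of sizes $\lambda_1,\lambda_2,\dots$. Similarly, two tableaux are $v$-equivalent if one can be obtained from the other by permuting entries within columns and permuting columns of equal length; a vertical tableau is a $v$-equivalence class, so its columns form a set partition of $\{1,\dots,N\}$. A horizontal tableau $\mu$ with rows $r_1,\dots,r_p$ and a vertical tableau $\nu$ with columns $c_1,\dots,c_q$ are orthogonal, written $\mu\perp\nu$, if $|r_i\cap c_j|\le 1$ for all $i,j$. The matrix $K_\lambda$ has rows indexed by horizontal tableaux of shape $\lambda$, columns indexed by vertical tableaux of shape $\lambda$, and entry $K_\lambda^{\mu,\nu}=1$ if $\mu\perp\nu$ and $0$ otherwise. For $\lambda=\mathbf{2\times n}$ (so $N=2n$), a horizontal tableau is an unordered partition of $\{1,\dots,2n\}$ into two $n$-element rows, and a vertical tableau is a partition of $\{1,\dots,2n\}$ into $n$ two-element columns. -}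

module Defs where

open import Data.Nat using (ℕ; _*_)
open import Data.Bool using (Bool; true; false; if_then_else_)
open import Data.Fin using (Fin)
open import Data.Fin.Subset using (Subset; ∁; ∣_∣; _∈_; _∉_)
open import Data.Fin.Subset.Properties using (_∈?_)
open import Data.Fin.Properties using (all?)
open import Data.Vec using (lookup)
open import Data.Product using (Σ; _×_; _,_; proj₁; proj₂)
open import Data.Sum using (_⊎_)
open import Data.List using (List; map; foldr)
open import Data.List.Relation.Unary.All using (All)
open import Data.List.Relation.Unary.AllPairs using (AllPairs)
open import Data.Rational using (ℚ; 0ℚ; 1ℚ) renaming (_*_ to _*ℚ_; _+_ to _+ℚ_)
import Data.Rational as Q
open import Relation.Nullary using (¬_; Dec; yes; no; does)
open import Relation.Nullary.Decidable using (_×-dec_; ¬?)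
open import Relation.Binary.PropositionalEquality using (_≡_; _≢_)

-- A horizontal tableau of shape 2×n on {0,…,2n-1} is an unordered pair
-- {A, ∁A} of n-element rows.  We represent it by one of its rows A
-- (a subset of size n); A and ∁ A represent the same horizontal tableau.
IsRow : (n : ℕ) → Subset (2 * n) → Set
IsRow n A = ∣ A ∣ ≡ n

SameHorizontal : {N : ℕ} → Subset N → Subset N → Set
SameHorizontal A B = A ≡ B ⊎ A ≡ ∁ B

-- A vertical tableau of shape 2×n: a partition of {0,…,2n-1} into
-- n two-element columns, encoded as the fixed-point-free involution
-- swapping the two entries of each column (columns are {i , f i}).
Vertical : ℕ → Set
Vertical N = Σ (Fin N → Fin N) λ f → (∀ i → f (f i) ≡ i) × (∀ i → f i ≢ i)

Orthogonal : {N : ℕ} → Subset N → Vertical N → Set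
Orthogonal A (f , _) =
  ∀ i → ¬ (i ∈ A × f i ∈ A) × ¬ (i ∈ ∁ A × f i ∈ ∁ A)

orthogonal? : {N : ℕ} (A : Subset N) (ν : Vertical N) → Dec (Orthogonal A ν)
orthogonal? A (f , _) = all? λ i →
  ¬? ((i ∈? A) ×-dec (f i ∈? A)) ×-dec ¬? ((i ∈? ∁ A) ×-dec (f i ∈? ∁ A))

K : {N : ℕ} → Subset N → Vertical N → ℚ
K A ν = if does (orthogonal? A ν) then 1ℚ else 0ℚ

RowsLinearlyIndependent : ℕ → Set
RowsLinearlyIndependent n =
  (ps : List (Subset (2 * n) × ℚ)) →
  All (λ p → IsRow n (proj₁ p)) ps →
  AllPairs (λ p q → ¬ SameHorizontal (proj₁ p) (proj₁ q)) ps →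
  (∀ (ν : Vertical (2 * n)) → foldr _+ℚ_ 0ℚ (map (λ p → proj₂ p *ℚ K (proj₁ p) ν) ps) ≡ 0ℚ) →
  All (λ p → proj₂ p ≡ 0ℚ) ps

-- Record a combination of rows as a list of pairs (A , c), and let the weight of B be the total
-- coefficient of the horizontal tableau {B , ∁ B}. By induction on N: if a combination of arbitrary
-- subsets of {0, …, N-1} annihilates every vertical tableau, then every balanced B has weight 0.
-- Restricting to the vertical tableaux containing the column {0 , 1} contracts the combination to
-- N - 2 points, because K (x ∷ y ∷ A) (ν ∪ {0 , 1}) = [x ≠ y] · K A ν; by induction the weights of
-- 1 ∷ 0 ∷ Q and 0 ∷ 1 ∷ Q cancel. Since K is invariant under relabelling the ground set, the weights
-- of any two balanced sets that differ by an exchange of an element and a non-element cancel. For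
-- N ≥ 3 three such exchanges form an odd cycle through B, so weight B = - weight B; for N = 2 the
-- exchange turns B into ∁ B, which has the same weight. Distinct horizontal tableaux have
-- independent weights, so every coefficient vanishes.

module Submission where

open import Defs

open import Algebra.Bundles using (CommutativeMonoid)
open import Data.Bool using (Bool; true; false; not; if_then_else_)
open import Data.Bool.Properties using (not-injective; not-involutive) renaming (_≟_ to _≟ᵇ_)
open import Data.Empty using (⊥-elim)
open import Data.Fin using (Fin; zero; suc; punchOut)
import Data.Fin.Properties as Fin
open import Data.Fin.Permutation
  using (Permutation′; _⟨$⟩ʳ_; _⟨$⟩ˡ_; inverseˡ; inverseʳ; remove; insert) renaming (id to idₚ)
open import Data.Fin.Subset using (Subset; ∁; ∣_∣; _∈_)
open import Data.Fin.Subset.Properties using (∣∁p∣≡n∸∣p∣)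
open import Data.List using (List; []; _∷_; map; foldr)
open import Data.List.Properties using (map-cong; map-∘)
open import Data.List.Relation.Unary.All as All using (All; []; _∷_)
open import Data.List.Relation.Unary.AllPairs using (AllPairs; []; _∷_)
open import Data.Nat as ℕ using (ℕ; zero; suc; _≤_)
import Data.Nat.Properties as ℕ
open import Data.Product using (∃; ∃₂; _×_; _,_; proj₁; proj₂; map₁; uncurry)
open import Data.Rational using (ℚ; 0ℚ; 1ℚ; ½; _+_; _-_; _*_)
import Data.Rational.Properties as ℚ
open import Data.Rational.Solver using (module +-*-Solver)
open import Data.Sum using (inj₁; inj₂)
open import Data.Vec using ([]; _∷_; lookup; tabulate; removeAt; _[_]≔_)
open import Data.Vec.Properties
  using ( lookup∘tabulate; lookup-map; tabulate-∘; tabulate-cong; lookup⇒[]=; []=⇒lookup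
        ; removeAt-punchOut; lookup∘update; lookup∘update′; ≡-dec)
open import Data.Vec.Relation.Binary.Pointwise.Extensional using (ext; Pointwise-≡⇒≡)
open import Function using (_∘_; id; _⇔_; mk⇔; Equivalence)
open import Function.Construct.Composition using (_⇔-∘_)
open import Function.Construct.Symmetry using (⇔-sym)
open import Relation.Binary.PropositionalEquality
open import Relation.Nullary using (¬_; Dec; does; yes; no)
open import Relation.Nullary.Decidable using (does-⇔; dec-true; dec-false)

open import Algebra.Properties.CommutativeSemigroup
  (CommutativeMonoid.commutativeSemigroup ℚ.+-0-commutativeMonoid)
  using () renaming (interchange to +-interchange)

∑ : {X : Set} → (X → ℚ) → List X → ℚ
∑ h xs = foldr _+_ 0ℚ (map h xs)

module _ {X : Set} where

  ∑-cong : {h k : X → ℚ} → (∀ x → h x ≡ k x) → ∀ xs → ∑ h xs ≡ ∑ k xs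
  ∑-cong h≗k xs = cong (foldr _+_ 0ℚ) (map-cong h≗k xs)

  ∑-map : {Y : Set} (h : Y → ℚ) (r : X → Y) (xs : List X) → ∑ h (map r xs) ≡ ∑ (h ∘ r) xs
  ∑-map h r xs = cong (foldr _+_ 0ℚ) (sym (map-∘ xs))

  ∑-+ : (h k : X → ℚ) (xs : List X) → ∑ (λ x → h x + k x) xs ≡ ∑ h xs + ∑ k xs
  ∑-+ h k [] = refl
  ∑-+ h k (x ∷ xs) =
    trans (cong (h x + k x +_) (∑-+ h k xs)) (+-interchange (h x) (k x) (∑ h xs) (∑ k xs))

  ∑-zero : (h : X → ℚ) {xs : List X} → All (λ x → h x ≡ 0ℚ) xs → ∑ h xs ≡ 0ℚ
  ∑-zero h [] = refl
  ∑-zero h (hx≡0 ∷ hxs≡0) = cong₂ _+_ hx≡0 (∑-zero h hxs≡0)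

𝟙 : {P : Set} → Dec P → ℚ
𝟙 P? = if does P? then 1ℚ else 0ℚ

𝟙-⇔ : {P Q : Set} → P ⇔ Q → (P? : Dec P) (Q? : Dec Q) → 𝟙 P? ≡ 𝟙 Q?
𝟙-⇔ P⇔Q P? Q? = cong (if_then 1ℚ else 0ℚ) (does-⇔ P⇔Q P? Q?)

𝟙-yes : {P : Set} (P? : Dec P) → P → 𝟙 P? ≡ 1ℚ
𝟙-yes P? p = cong (if_then 1ℚ else 0ℚ) (dec-true P? p)

𝟙-no : {P : Set} (P? : Dec P) → ¬ P → 𝟙 P? ≡ 0ℚ
𝟙-no P? ¬p = cong (if_then 1ℚ else 0ℚ) (dec-false P? ¬p)

module _ {N : ℕ} where

  infix 4 _≟ˢ_
  _≟ˢ_ : (A B : Subset N) → Dec (A ≡ B)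
  _≟ˢ_ = ≡-dec _≟ᵇ_

  lookup-ext : {A B : Subset N} → (∀ i → lookup A i ≡ lookup B i) → A ≡ B
  lookup-ext A≗B = Pointwise-≡⇒≡ (ext A≗B)

  lookup-∁ : (A : Subset N) (i : Fin N) → lookup (∁ A) i ≡ not (lookup A i)
  lookup-∁ A i = lookup-map i not A

  lookup-∁≡true : (A : Subset N) (i : Fin N) → lookup (∁ A) i ≡ true → lookup A i ≡ false
  lookup-∁≡true A i ∁A-i = not-injective (trans (sym (lookup-∁ A i)) ∁A-i)

  ∁-flips : (A : Subset N) (i : Fin N) {x : Bool} → lookup A i ≡ x → lookup (∁ A) i ≡ not x
  ∁-flips A i A-i = trans (lookup-∁ A i) (cong not A-i)

  lookup-true-false⇒≢ : (A : Subset N) {i j : Fin N} → lookup A i ≡ true → lookup A j ≡ false → i ≢ j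
  lookup-true-false⇒≢ A A-i A-j refl with () ← trans (sym A-i) A-j

  ∁-involutive : (A : Subset N) → ∁ (∁ A) ≡ A
  ∁-involutive A = lookup-ext λ i → begin
    lookup (∁ (∁ A)) i     ≡⟨ lookup-∁ (∁ A) i ⟩
    not (lookup (∁ A) i)   ≡⟨ cong not (lookup-∁ A i) ⟩
    not (not (lookup A i)) ≡⟨ not-involutive (lookup A i) ⟩
    lookup A i             ∎
    where open ≡-Reasoning

  Separates : Subset N → (Fin N → Fin N) → Set
  Separates A f = ∀ i → lookup A i ≢ lookup A (f i)

  orthogonal⇔separates : (A : Subset N) (ν : Vertical N) → Orthogonal A ν ⇔ Separates A (proj₁ ν)
  orthogonal⇔separates A ν@(f , _) = mk⇔ to from
    where
    ∈∁⇒lookup≡false : ∀ {i} → i ∈ ∁ A → lookup A i ≡ false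
    ∈∁⇒lookup≡false {i} i∈∁A = lookup-∁≡true A i ([]=⇒lookup i∈∁A)
    to : Orthogonal A ν → Separates A f
    to o i Ai≡Afi with lookup A i in Ai
    ... | true  = proj₁ (o i) (lookup⇒[]= i A Ai , lookup⇒[]= (f i) A (sym Ai≡Afi))
    ... | false = proj₂ (o i) ( lookup⇒[]= i (∁ A) (∁-flips A i Ai)
                              , lookup⇒[]= (f i) (∁ A) (∁-flips A (f i) (sym Ai≡Afi)))
    from : Separates A f → Orthogonal A ν
    from s i = (λ (i∈A , fi∈A) → s i (trans ([]=⇒lookup i∈A) (sym ([]=⇒lookup fi∈A))))
             , (λ (i∈∁A , fi∈∁A) → s i (trans (∈∁⇒lookup≡false i∈∁A) (sym (∈∁⇒lookup≡false fi∈∁A))))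

  K-nonseparating : (A : Subset N) (ν : Vertical N) → ¬ Separates A (proj₁ ν) → K A ν ≡ 0ℚ
  K-nonseparating A ν ¬s = 𝟙-no (orthogonal? A ν) (¬s ∘ Equivalence.to (orthogonal⇔separates A ν))

K-cong : {N N′ : ℕ} (A : Subset N) (ν : Vertical N) (A′ : Subset N′) (ν′ : Vertical N′) →
         Separates A (proj₁ ν) ⇔ Separates A′ (proj₁ ν′) → K A ν ≡ K A′ ν′
K-cong A ν A′ ν′ A⇔A′ = 𝟙-⇔
  (⇔-sym (orthogonal⇔separates A′ ν′) ⇔-∘ (A⇔A′ ⇔-∘ orthogonal⇔separates A ν))
  (orthogonal? A ν) (orthogonal? A′ ν′)

Combination : ℕ → Set
Combination N = List (Subset N × ℚ)

module _ {N : ℕ} where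

  Annihilates : Combination N → Set
  Annihilates ps = ∀ ν → ∑ (λ p → proj₂ p * K (proj₁ p) ν) ps ≡ 0ℚ

  coefficient : Combination N → Subset N → ℚ
  coefficient ps B = ∑ (λ p → proj₂ p * 𝟙 (proj₁ p ≟ˢ B)) ps

  weight : Combination N → Subset N → ℚ
  weight ps B = coefficient ps B + coefficient ps (∁ B)

  weight-∁ : (ps : Combination N) (B : Subset N) → weight ps (∁ B) ≡ weight ps B
  weight-∁ ps B = trans (cong (coefficient ps (∁ B) +_) (cong (coefficient ps) (∁-involutive B)))
                        (ℚ.+-comm (coefficient ps (∁ B)) (coefficient ps B))

  Balanced : Subset N → Set
  Balanced B = ∣ B ∣ ≡ ∣ ∁ B ∣

-- Over all combinations, not only those of rows: contraction does not preserve rows.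
WeightsVanish : ℕ → Set
WeightsVanish N =
  (ps : Combination N) → Annihilates ps → (B : Subset N) → Balanced B → weight ps B ≡ 0ℚ

module _ {N : ℕ} where

  infixl 9 _∘ˢ_
  _∘ˢ_ : Subset N → Permutation′ N → Subset N
  A ∘ˢ ρ = tabulate (lookup A ∘ (ρ ⟨$⟩ʳ_))

  lookup-∘ˢ : (A : Subset N) (ρ : Permutation′ N) (i : Fin N) →
              lookup (A ∘ˢ ρ) i ≡ lookup A (ρ ⟨$⟩ʳ i)
  lookup-∘ˢ A ρ = lookup∘tabulate (lookup A ∘ (ρ ⟨$⟩ʳ_))

  ∘ˢ-injective : (ρ : Permutation′ N) {A B : Subset N} → A ∘ˢ ρ ≡ B ∘ˢ ρ → A ≡ B
  ∘ˢ-injective ρ {A} {B} eq = lookup-ext λ i → begin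
    lookup A i                   ≡⟨ cong (lookup A) (inverseʳ ρ) ⟨
    lookup A (ρ ⟨$⟩ʳ (ρ ⟨$⟩ˡ i)) ≡⟨ lookup-∘ˢ A ρ (ρ ⟨$⟩ˡ i) ⟨
    lookup (A ∘ˢ ρ) (ρ ⟨$⟩ˡ i)   ≡⟨ cong (λ X → lookup X (ρ ⟨$⟩ˡ i)) eq ⟩
    lookup (B ∘ˢ ρ) (ρ ⟨$⟩ˡ i)   ≡⟨ lookup-∘ˢ B ρ (ρ ⟨$⟩ˡ i) ⟩
    lookup B (ρ ⟨$⟩ʳ (ρ ⟨$⟩ˡ i)) ≡⟨ cong (lookup B) (inverseʳ ρ) ⟩
    lookup B i                   ∎
    where open ≡-Reasoning

  ∁-∘ˢ : (A : Subset N) (ρ : Permutation′ N) → ∁ (A ∘ˢ ρ) ≡ ∁ A ∘ˢ ρ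
  ∁-∘ˢ A ρ = trans (sym (tabulate-∘ not (lookup A ∘ (ρ ⟨$⟩ʳ_))))
                   (tabulate-cong (λ i → sym (lookup-∁ A (ρ ⟨$⟩ʳ i))))

  conjugate : Permutation′ N → Vertical N → Vertical N
  conjugate ρ (f , involutive , fixpoint-free) = ρ⁺ ∘ f ∘ ρ⁻ , involutive′ , fixpoint-free′
    where
    ρ⁺ ρ⁻ : Fin N → Fin N
    ρ⁺ = ρ ⟨$⟩ʳ_
    ρ⁻ = ρ ⟨$⟩ˡ_
    involutive′ : ∀ i → ρ⁺ (f (ρ⁻ (ρ⁺ (f (ρ⁻ i))))) ≡ i
    involutive′ i = begin
      ρ⁺ (f (ρ⁻ (ρ⁺ (f (ρ⁻ i))))) ≡⟨ cong (ρ⁺ ∘ f) (inverseˡ ρ) ⟩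
      ρ⁺ (f (f (ρ⁻ i)))           ≡⟨ cong ρ⁺ (involutive (ρ⁻ i)) ⟩
      ρ⁺ (ρ⁻ i)                   ≡⟨ inverseʳ ρ ⟩
      i                           ∎
      where open ≡-Reasoning
    fixpoint-free′ : ∀ i → ρ⁺ (f (ρ⁻ i)) ≢ i
    fixpoint-free′ i eq = fixpoint-free (ρ⁻ i) (trans (sym (inverseˡ ρ)) (cong ρ⁻ eq))

  K-∘ˢ : (A : Subset N) (ρ : Permutation′ N) (ν : Vertical N) → K (A ∘ˢ ρ) ν ≡ K A (conjugate ρ ν)
  K-∘ˢ A ρ ν@(f , _) = K-cong (A ∘ˢ ρ) ν A (conjugate ρ ν) (mk⇔ to from)
    where
    ρ⁺ ρ⁻ : Fin N → Fin N
    ρ⁺ = ρ ⟨$⟩ʳ_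
    ρ⁻ = ρ ⟨$⟩ˡ_
    to : Separates (A ∘ˢ ρ) f → Separates A (ρ⁺ ∘ f ∘ ρ⁻)
    to s i eq = s (ρ⁻ i) (begin
      lookup (A ∘ˢ ρ) (ρ⁻ i)     ≡⟨ lookup-∘ˢ A ρ (ρ⁻ i) ⟩
      lookup A (ρ⁺ (ρ⁻ i))       ≡⟨ cong (lookup A) (inverseʳ ρ) ⟩
      lookup A i                 ≡⟨ eq ⟩
      lookup A (ρ⁺ (f (ρ⁻ i)))   ≡⟨ lookup-∘ˢ A ρ (f (ρ⁻ i)) ⟨
      lookup (A ∘ˢ ρ) (f (ρ⁻ i)) ∎)
      where open ≡-Reasoning
    from : Separates A (ρ⁺ ∘ f ∘ ρ⁻) → Separates (A ∘ˢ ρ) f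
    from s i eq = s (ρ⁺ i) (begin
      lookup A (ρ⁺ i)             ≡⟨ lookup-∘ˢ A ρ i ⟨
      lookup (A ∘ˢ ρ) i           ≡⟨ eq ⟩
      lookup (A ∘ˢ ρ) (f i)       ≡⟨ lookup-∘ˢ A ρ (f i) ⟩
      lookup A (ρ⁺ (f i))         ≡⟨ cong (lookup A ∘ ρ⁺ ∘ f) (inverseˡ ρ) ⟨
      lookup A (ρ⁺ (f (ρ⁻ (ρ⁺ i)))) ∎)
      where open ≡-Reasoning

  relabel : Permutation′ N → Combination N → Combination N
  relabel ρ = map (map₁ (_∘ˢ ρ))

  annihilates-relabel : (ρ : Permutation′ N) (ps : Combination N) →
                        Annihilates ps → Annihilates (relabel ρ ps)
  annihilates-relabel ρ ps ann ν = begin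
    ∑ (λ p → proj₂ p * K (proj₁ p) ν) (relabel ρ ps)
      ≡⟨ ∑-map _ (map₁ (_∘ˢ ρ)) ps ⟩
    ∑ (λ p → proj₂ p * K (proj₁ p ∘ˢ ρ) ν) ps
      ≡⟨ ∑-cong (λ p → cong (proj₂ p *_) (K-∘ˢ (proj₁ p) ρ ν)) ps ⟩
    ∑ (λ p → proj₂ p * K (proj₁ p) (conjugate ρ ν)) ps
      ≡⟨ ann (conjugate ρ ν) ⟩
    0ℚ ∎
    where open ≡-Reasoning

  coefficient-relabel : (ρ : Permutation′ N) (ps : Combination N) (B : Subset N) →
                        coefficient (relabel ρ ps) (B ∘ˢ ρ) ≡ coefficient ps B
  coefficient-relabel ρ ps B = trans (∑-map _ (map₁ (_∘ˢ ρ)) ps) (∑-cong (λ p → cong (proj₂ p *_)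
    (𝟙-⇔ (mk⇔ (∘ˢ-injective ρ) (cong (_∘ˢ ρ))) (proj₁ p ∘ˢ ρ ≟ˢ B ∘ˢ ρ) (proj₁ p ≟ˢ B))) ps)

  weight-relabel : (ρ : Permutation′ N) (ps : Combination N) (B : Subset N) →
                   weight (relabel ρ ps) (B ∘ˢ ρ) ≡ weight ps B
  weight-relabel ρ ps B = cong₂ _+_ (coefficient-relabel ρ ps B)
    (trans (cong (coefficient (relabel ρ ps)) (∁-∘ˢ B ρ)) (coefficient-relabel ρ ps (∁ B)))

∣∷∣-cong : {N : ℕ} (x : Bool) (A B : Subset N) → ∣ A ∣ ≡ ∣ B ∣ → ∣ x ∷ A ∣ ≡ ∣ x ∷ B ∣
∣∷∣-cong true  A B = cong suc
∣∷∣-cong false A B = id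

∣∷∷∣-comm : {N : ℕ} (x y : Bool) (A : Subset N) → ∣ x ∷ y ∷ A ∣ ≡ ∣ y ∷ x ∷ A ∣
∣∷∷∣-comm true  true  A = refl
∣∷∷∣-comm true  false A = refl
∣∷∷∣-comm false true  A = refl
∣∷∷∣-comm false false A = refl

∣∣-removeAt : {N : ℕ} (A : Subset (suc N)) (i : Fin (suc N)) → ∣ A ∣ ≡ ∣ lookup A i ∷ removeAt A i ∣
∣∣-removeAt (x ∷ A)     zero    = refl
∣∣-removeAt (x ∷ y ∷ A) (suc i) =
  trans (∣∷∣-cong x (y ∷ A) (yᵢ ∷ removeAt (y ∷ A) i) (∣∣-removeAt (y ∷ A) i))
        (∣∷∷∣-comm x yᵢ (removeAt (y ∷ A) i))
  where
  yᵢ : Bool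
  yᵢ = lookup (y ∷ A) i

∣∘ˢ∣ : {N : ℕ} (A : Subset N) (ρ : Permutation′ N) → ∣ A ∘ˢ ρ ∣ ≡ ∣ A ∣
∣∘ˢ∣ {zero}  [] ρ = refl
∣∘ˢ∣ {suc N} A  ρ = begin
  ∣ A ∘ˢ ρ ∣                  ≡⟨ cong (λ B → ∣ A₀ ∷ B ∣) tail≡ ⟩
  ∣ A₀ ∷ A′ ∘ˢ remove zero ρ ∣ ≡⟨ ∣∷∣-cong A₀ (A′ ∘ˢ remove zero ρ) A′ (∣∘ˢ∣ A′ (remove zero ρ)) ⟩
  ∣ A₀ ∷ A′ ∣                 ≡⟨ ∣∣-removeAt A (ρ ⟨$⟩ʳ zero) ⟨
  ∣ A ∣                       ∎
  where
  open ≡-Reasoning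
  A₀ : Bool
  A₀ = lookup A (ρ ⟨$⟩ʳ zero)
  A′ : Subset N
  A′ = removeAt A (ρ ⟨$⟩ʳ zero)
  tail≡ : tabulate (λ k → lookup A (ρ ⟨$⟩ʳ suc k)) ≡ A′ ∘ˢ remove zero ρ
  tail≡ = tabulate-cong λ k → sym (removeAt-punchOut A _)

balanced-∘ˢ : {N : ℕ} (A : Subset N) (ρ : Permutation′ N) → Balanced (A ∘ˢ ρ) ⇔ Balanced A
balanced-∘ˢ A ρ = mk⇔ (λ balanced → trans (sym (∣∘ˢ∣ A ρ)) (trans balanced ∣∁∘ˢ∣))
                      (λ balanced → trans (∣∘ˢ∣ A ρ) (trans balanced (sym ∣∁∘ˢ∣)))
  where
  ∣∁∘ˢ∣ : ∣ ∁ (A ∘ˢ ρ) ∣ ≡ ∣ ∁ A ∣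
  ∣∁∘ˢ∣ = trans (cong ∣_∣ (∁-∘ˢ A ρ)) (∣∘ˢ∣ (∁ A) ρ)

module _ {M : ℕ} where

  pairUp : Vertical M → Vertical (suc (suc M))
  pairUp (f , involutive , fixpoint-free) = f′ , involutive′ , fixpoint-free′
    where
    f′ : Fin (suc (suc M)) → Fin (suc (suc M))
    f′ zero          = suc zero
    f′ (suc zero)    = zero
    f′ (suc (suc i)) = suc (suc (f i))
    involutive′ : ∀ i → f′ (f′ i) ≡ i
    involutive′ zero          = refl
    involutive′ (suc zero)    = refl
    involutive′ (suc (suc i)) = cong (λ j → suc (suc j)) (involutive i)
    fixpoint-free′ : ∀ i → f′ i ≢ i
    fixpoint-free′ zero          ()
    fixpoint-free′ (suc zero)    ()
    fixpoint-free′ (suc (suc i)) eq = fixpoint-free i (Fin.suc-injective (Fin.suc-injective eq))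

  differ : Bool → Bool → ℚ
  differ true  true  = 0ℚ
  differ true  false = 1ℚ
  differ false true  = 1ℚ
  differ false false = 0ℚ

  separates-pairUp : {x y : Bool} {A : Subset M} (ν : Vertical M) → x ≢ y →
                     Separates (x ∷ y ∷ A) (proj₁ (pairUp ν)) ⇔ Separates A (proj₁ ν)
  separates-pairUp ν x≢y = mk⇔ (λ s i → s (suc (suc i)))
    λ { s zero → x≢y ; s (suc zero) → x≢y ∘ sym ; s (suc (suc i)) → s i }

  K-pairUp : (x y : Bool) (A : Subset M) (ν : Vertical M) → K (x ∷ y ∷ A) (pairUp ν) ≡ differ x y * K A ν
  K-pairUp true  true  A ν =
    trans (K-nonseparating (true ∷ true ∷ A) (pairUp ν) (λ s → s zero refl)) (sym (ℚ.*-zeroˡ (K A ν)))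
  K-pairUp false false A ν =
    trans (K-nonseparating (false ∷ false ∷ A) (pairUp ν) (λ s → s zero refl)) (sym (ℚ.*-zeroˡ (K A ν)))
  K-pairUp true  false A ν =
    trans (K-cong (true ∷ false ∷ A) (pairUp ν) A ν (separates-pairUp ν λ ())) (sym (ℚ.*-identityˡ (K A ν)))
  K-pairUp false true  A ν =
    trans (K-cong (false ∷ true ∷ A) (pairUp ν) A ν (separates-pairUp ν λ ())) (sym (ℚ.*-identityˡ (K A ν)))

  contract : Subset (suc (suc M)) × ℚ → Subset M × ℚ
  contract (x ∷ y ∷ A , c) = A , differ x y * c

  annihilates-contract : (ps : Combination (suc (suc M))) → Annihilates ps → Annihilates (map contract ps)
  annihilates-contract ps ann ν = begin
    ∑ (λ p → proj₂ p * K (proj₁ p) ν) (map contract ps)         ≡⟨ ∑-map _ contract ps ⟩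
    ∑ (λ p → proj₂ (contract p) * K (proj₁ (contract p)) ν) ps ≡⟨ ∑-cong entry ps ⟩
    ∑ (λ p → proj₂ p * K (proj₁ p) (pairUp ν)) ps               ≡⟨ ann (pairUp ν) ⟩
    0ℚ                                                          ∎
    where
    open ≡-Reasoning
    entry : ∀ p → proj₂ (contract p) * K (proj₁ (contract p)) ν ≡ proj₂ p * K (proj₁ p) (pairUp ν)
    entry (x ∷ y ∷ A , c) = begin
      (differ x y * c) * K A ν
        ≡⟨ solve 3 (λ d c k → (d :* c) :* k := c :* (d :* k)) refl (differ x y) c (K A ν) ⟩
      c * (differ x y * K A ν)
        ≡⟨ cong (c *_) (K-pairUp x y A ν) ⟨
      c * K (x ∷ y ∷ A) (pairUp ν) ∎
      where open +-*-Solver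

  coefficient-contract : (ps : Combination (suc (suc M))) (Q : Subset M) →
    coefficient (map contract ps) Q ≡ coefficient ps (true ∷ false ∷ Q) + coefficient ps (false ∷ true ∷ Q)
  coefficient-contract ps Q = begin
    coefficient (map contract ps) Q                                       ≡⟨ ∑-map _ contract ps ⟩
    ∑ (λ p → proj₂ (contract p) * 𝟙 (proj₁ (contract p) ≟ˢ Q)) ps        ≡⟨ ∑-cong entry ps ⟩
    ∑ (λ p → proj₂ p * 𝟙 (proj₁ p ≟ˢ true ∷ false ∷ Q)
           + proj₂ p * 𝟙 (proj₁ p ≟ˢ false ∷ true ∷ Q)) ps                ≡⟨ ∑-+ _ _ ps ⟩
    coefficient ps (true ∷ false ∷ Q) + coefficient ps (false ∷ true ∷ Q) ∎
    where
    open ≡-Reasoning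
    open +-*-Solver
    -- Once x and y are known, each 𝟙 (x ∷ y ∷ A ≟ˢ _) computes to 𝟙 (A ≟ˢ Q) or to 0ℚ.
    entry : ∀ p → proj₂ (contract p) * 𝟙 (proj₁ (contract p) ≟ˢ Q)
                ≡ proj₂ p * 𝟙 (proj₁ p ≟ˢ true ∷ false ∷ Q) + proj₂ p * 𝟙 (proj₁ p ≟ˢ false ∷ true ∷ Q)
    entry (true  ∷ true  ∷ A , c) =
      solve 2 (λ c e → (con 0ℚ :* c) :* e := c :* con 0ℚ :+ c :* con 0ℚ) refl c (𝟙 (A ≟ˢ Q))
    entry (true  ∷ false ∷ A , c) =
      solve 2 (λ c e → (con 1ℚ :* c) :* e := c :* e :+ c :* con 0ℚ) refl c (𝟙 (A ≟ˢ Q))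
    entry (false ∷ true  ∷ A , c) =
      solve 2 (λ c e → (con 1ℚ :* c) :* e := c :* con 0ℚ :+ c :* e) refl c (𝟙 (A ≟ˢ Q))
    entry (false ∷ false ∷ A , c) =
      solve 2 (λ c e → (con 0ℚ :* c) :* e := c :* con 0ℚ :+ c :* con 0ℚ) refl c (𝟙 (A ≟ˢ Q))

  weight-contract : (ps : Combination (suc (suc M))) (Q : Subset M) →
    weight (map contract ps) Q ≡ weight ps (true ∷ false ∷ Q) + weight ps (false ∷ true ∷ Q)
  weight-contract ps Q = begin
    weight (map contract ps) Q
      ≡⟨ cong₂ _+_ (coefficient-contract ps Q) (coefficient-contract ps (∁ Q)) ⟩
    (c₁₀ Q + c₀₁ Q) + (c₁₀ (∁ Q) + c₀₁ (∁ Q))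
      ≡⟨ cong (c₁₀ Q + c₀₁ Q +_) (ℚ.+-comm (c₁₀ (∁ Q)) (c₀₁ (∁ Q))) ⟩
    (c₁₀ Q + c₀₁ Q) + (c₀₁ (∁ Q) + c₁₀ (∁ Q))
      ≡⟨ +-interchange (c₁₀ Q) (c₀₁ Q) (c₀₁ (∁ Q)) (c₁₀ (∁ Q)) ⟩
    (c₁₀ Q + c₀₁ (∁ Q)) + (c₀₁ Q + c₁₀ (∁ Q)) ∎
    where
    open ≡-Reasoning
    c₁₀ c₀₁ : Subset M → ℚ
    c₁₀ Q = coefficient ps (true ∷ false ∷ Q)
    c₀₁ Q = coefficient ps (false ∷ true ∷ Q)

  exchange₀₁-weights-cancel : WeightsVanish M → (ps : Combination (suc (suc M))) → Annihilates ps →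
    (Q : Subset M) → Balanced Q → weight ps (true ∷ false ∷ Q) + weight ps (false ∷ true ∷ Q) ≡ 0ℚ
  exchange₀₁-weights-cancel ih ps ann Q balanced =
    trans (sym (weight-contract ps Q)) (ih (map contract ps) (annihilates-contract ps ann) Q balanced)

⟨$⟩ʳ-injective : {N : ℕ} (ρ : Permutation′ N) {i j : Fin N} → ρ ⟨$⟩ʳ i ≡ ρ ⟨$⟩ʳ j → i ≡ j
⟨$⟩ʳ-injective ρ eq = trans (sym (inverseˡ ρ)) (trans (cong (ρ ⟨$⟩ˡ_) eq) (inverseˡ ρ))

module _ {M : ℕ} {a b : Fin (suc (suc M))} (a≢b : a ≢ b) where

  placePair : Permutation′ (suc (suc M))
  placePair = insert zero a (insert zero (punchOut a≢b) idₚ)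

  placePair-0 : placePair ⟨$⟩ʳ zero ≡ a
  placePair-0 = refl

  placePair-1 : placePair ⟨$⟩ʳ suc zero ≡ b
  placePair-1 = Fin.punchIn-punchOut a≢b

  placePair-avoids : (k : Fin M) → placePair ⟨$⟩ʳ suc (suc k) ≢ a × placePair ⟨$⟩ʳ suc (suc k) ≢ b
  placePair-avoids k = (λ eq → 0≢2+k (⟨$⟩ʳ-injective placePair (trans placePair-0 (sym eq))))
                     , (λ eq → 1≢2+k (⟨$⟩ʳ-injective placePair (trans placePair-1 (sym eq))))
    where
    0≢2+k : zero ≢ suc (suc k)
    0≢2+k ()
    1≢2+k : suc zero ≢ suc (suc k)
    1≢2+k ()

record Exchange {N : ℕ} (a b : Fin N) (X Y : Subset N) : Set where
  field
    X-a : lookup X a ≡ true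
    X-b : lookup X b ≡ false
    Y-a : lookup Y a ≡ false
    Y-b : lookup Y b ≡ true
    elsewhere : ∀ z → z ≢ a → z ≢ b → lookup X z ≡ lookup Y z

  a≢b : a ≢ b
  a≢b = lookup-true-false⇒≢ X X-a X-b

module _ {M : ℕ} {a b : Fin (suc (suc M))} {X Y : Subset (suc (suc M))} (e : Exchange a b X Y) where

  open Exchange e

  private
    ρ : Permutation′ (suc (suc M))
    ρ = placePair a≢b

    rest : Subset M
    rest = tabulate (λ k → lookup X (ρ ⟨$⟩ʳ suc (suc k)))

    X∘ˢρ : X ∘ˢ ρ ≡ true ∷ false ∷ rest
    X∘ˢρ = cong₂ (λ x y → x ∷ y ∷ rest) X-a (trans (cong (lookup X) (placePair-1 a≢b)) X-b)

    Y∘ˢρ : Y ∘ˢ ρ ≡ false ∷ true ∷ rest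
    Y∘ˢρ = cong₂ _∷_ Y-a (cong₂ _∷_ (trans (cong (lookup Y) (placePair-1 a≢b)) Y-b)
                 (tabulate-cong λ k → sym (uncurry (elsewhere _) (placePair-avoids a≢b k))))

    balanced-rest : Balanced X → Balanced rest
    balanced-rest balanced =
      ℕ.suc-injective (subst Balanced X∘ˢρ (Equivalence.from (balanced-∘ˢ X ρ) balanced))

  exchange-balanced : Balanced X → Balanced Y
  exchange-balanced balanced =
    Equivalence.to (balanced-∘ˢ Y ρ) (subst Balanced (sym Y∘ˢρ) (cong suc (balanced-rest balanced)))

  exchange-weights-cancel : WeightsVanish M → (ps : Combination (suc (suc M))) → Annihilates ps →
                            Balanced X → weight ps X + weight ps Y ≡ 0ℚ
  exchange-weights-cancel ih ps ann balanced = begin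
    weight ps X + weight ps Y
      ≡⟨ cong₂ _+_ (weight-relabel ρ ps X) (weight-relabel ρ ps Y) ⟨
    weight ps′ (X ∘ˢ ρ) + weight ps′ (Y ∘ˢ ρ)
      ≡⟨ cong₂ (λ X′ Y′ → weight ps′ X′ + weight ps′ Y′) X∘ˢρ Y∘ˢρ ⟩
    weight ps′ (true ∷ false ∷ rest) + weight ps′ (false ∷ true ∷ rest)
      ≡⟨ exchange₀₁-weights-cancel ih ps′ (annihilates-relabel ρ ps ann) rest (balanced-rest balanced) ⟩
    0ℚ ∎
    where
    open ≡-Reasoning
    ps′ : Combination (suc (suc M))
    ps′ = relabel ρ ps

pairwise-sums-zero⇒zero : (x y z : ℚ) → x + y ≡ 0ℚ → y + z ≡ 0ℚ → x + z ≡ 0ℚ → x ≡ 0ℚ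
pairwise-sums-zero⇒zero x y z x+y≡0 y+z≡0 x+z≡0 = begin
  x
    ≡⟨ solve 3 (λ x y z → x := con ½ :* ((x :+ y) :- (y :+ z) :+ (x :+ z))) refl x y z ⟩
  ½ * ((x + y) - (y + z) + (x + z))
    ≡⟨ cong₂ (λ u v → ½ * (u - v + (x + z))) x+y≡0 y+z≡0 ⟩
  ½ * (0ℚ - 0ℚ + (x + z))
    ≡⟨ cong (λ w → ½ * (0ℚ - 0ℚ + w)) x+z≡0 ⟩
  ½ * (0ℚ - 0ℚ + 0ℚ)
    ≡⟨⟩
  0ℚ ∎
  where
  open ≡-Reasoning
  open +-*-Solver

exchange-triangle : {N : ℕ} (B : Subset N) {a b c : Fin N} → c ≢ a →
  lookup B a ≡ true → lookup B b ≡ false → lookup B c ≡ true →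
  ∃₂ λ B₁ B₂ → Exchange a b B B₁ × Exchange c a B₁ B₂ × Exchange c b B B₂
exchange-triangle {N} B {a} {b} {c} c≢a B-a B-b B-c = B₁ , B₂ , B↔B₁ , B₁↔B₂ , B↔B₂
  where
  B′ B₁ B₁′ B₂ : Subset N
  B′  = B [ a ]≔ false
  B₁  = B′ [ b ]≔ true
  B₁′ = B₁ [ c ]≔ false
  B₂  = B₁′ [ a ]≔ true
  a≢b : a ≢ b
  a≢b = lookup-true-false⇒≢ B B-a B-b
  c≢b : c ≢ b
  c≢b = lookup-true-false⇒≢ B B-c B-b
  B₁-a : lookup B₁ a ≡ false
  B₁-a = trans (lookup∘update′ a≢b B′ true) (lookup∘update a B false)
  B₁-c : lookup B₁ c ≡ true
  B₁-c = trans (lookup∘update′ c≢b B′ true) (trans (lookup∘update′ c≢a B false) B-c)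
  B₂-c : lookup B₂ c ≡ false
  B₂-c = trans (lookup∘update′ c≢a B₁′ true) (lookup∘update c B₁ false)
  B₂-b : lookup B₂ b ≡ true
  B₂-b = trans (lookup∘update′ (a≢b ∘ sym) B₁′ true)
               (trans (lookup∘update′ (c≢b ∘ sym) B₁ false) (lookup∘update b B′ true))
  B↔B₁ : Exchange a b B B₁
  B↔B₁ = record
    { X-a = B-a ; X-b = B-b ; Y-a = B₁-a ; Y-b = lookup∘update b B′ true
    ; elsewhere = λ z z≢a z≢b → sym (trans (lookup∘update′ z≢b B′ true) (lookup∘update′ z≢a B false))
    }
  B₁↔B₂ : Exchange c a B₁ B₂
  B₁↔B₂ = record
    { X-a = B₁-c ; X-b = B₁-a ; Y-a = B₂-c ; Y-b = lookup∘update a B₁′ true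
    ; elsewhere = λ z z≢c z≢a → sym (trans (lookup∘update′ z≢a B₁′ true) (lookup∘update′ z≢c B₁ false))
    }
  B↔B₂ : Exchange c b B B₂
  B↔B₂ = record { X-a = B-c ; X-b = B-b ; Y-a = B₂-c ; Y-b = B₂-b ; elsewhere = elsewhere }
    where
    elsewhere : ∀ z → z ≢ c → z ≢ b → lookup B z ≡ lookup B₂ z
    elsewhere z z≢c z≢b with z Fin.≟ a
    ... | yes refl = trans B-a (sym (lookup∘update z B₁′ true))
    ... | no z≢a   = sym (begin
      lookup B₂ z  ≡⟨ lookup∘update′ z≢a B₁′ true ⟩
      lookup B₁′ z ≡⟨ lookup∘update′ z≢c B₁ false ⟩
      lookup B₁ z  ≡⟨ lookup∘update′ z≢b B′ true ⟩
      lookup B′ z  ≡⟨ lookup∘update′ z≢a B false ⟩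
      lookup B z   ∎)
      where open ≡-Reasoning

weight-vanishes-at-three-points : {M : ℕ} → WeightsVanish M →
  (ps : Combination (suc (suc M))) → Annihilates ps → (B : Subset (suc (suc M))) → Balanced B →
  {a b c : Fin (suc (suc M))} → c ≢ a →
  lookup B a ≡ true → lookup B b ≡ false → lookup B c ≡ true → weight ps B ≡ 0ℚ
weight-vanishes-at-three-points ih ps ann B balanced c≢a B-a B-b B-c =
  let B₁ , B₂ , B↔B₁ , B₁↔B₂ , B↔B₂ = exchange-triangle B c≢a B-a B-b B-c in
  pairwise-sums-zero⇒zero (weight ps B) (weight ps B₁) (weight ps B₂)
    (exchange-weights-cancel B↔B₁ ih ps ann balanced)
    (exchange-weights-cancel B₁↔B₂ ih ps ann (exchange-balanced B↔B₁ balanced))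
    (exchange-weights-cancel B↔B₂ ih ps ann balanced)

third-point : {M : ℕ} (a b : Fin (suc (suc (suc M)))) → a ≢ b → ∃ λ c → c ≢ a × c ≢ b
third-point a b a≢b = placePair a≢b ⟨$⟩ʳ suc (suc zero) , placePair-avoids a≢b zero

member : {N : ℕ} (B : Subset N) → ∣ B ∣ ≢ 0 → ∃ λ a → lookup B a ≡ true
member []          ∣B∣≢0 = ⊥-elim (∣B∣≢0 refl)
member (true ∷ B)  _     = zero , refl
member (false ∷ B) ∣B∣≢0 = let a , B-a = member B ∣B∣≢0 in suc a , B-a

balanced-∁ : {N : ℕ} (B : Subset N) → Balanced B → Balanced (∁ B)
balanced-∁ B balanced = trans (sym balanced) (cong ∣_∣ (sym (∁-involutive B)))

balanced-member : {N : ℕ} (B : Subset (suc N)) → Balanced B → ∃ λ a → lookup B a ≡ true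
balanced-member {N} B balanced = member B λ ∣B∣≡0 → ℕ.0≢1+n (begin
  0               ≡⟨ ∣B∣≡0 ⟨
  ∣ B ∣           ≡⟨ balanced ⟩
  ∣ ∁ B ∣         ≡⟨ ∣∁p∣≡n∸∣p∣ B ⟩
  suc N ℕ.∸ ∣ B ∣ ≡⟨ cong (suc N ℕ.∸_) ∣B∣≡0 ⟩
  suc N           ∎)
  where open ≡-Reasoning

balanced-nonmember : {N : ℕ} (B : Subset (suc N)) → Balanced B → ∃ λ b → lookup B b ≡ false
balanced-nonmember B balanced =
  let b , ∁B-b = balanced-member (∁ B) (balanced-∁ B balanced) in b , lookup-∁≡true B b ∁B-b

weightsVanish-step : {M : ℕ} → WeightsVanish (suc M) → WeightsVanish (suc (suc (suc M)))
weightsVanish-step ih ps ann B balanced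
  with a , B-a ← balanced-member B balanced
  with b , B-b ← balanced-nonmember B balanced
  with c , c≢a , c≢b ← third-point a b (lookup-true-false⇒≢ B B-a B-b)
  with lookup B c in B-c
... | true  = weight-vanishes-at-three-points ih ps ann B balanced c≢a B-a B-b B-c
... | false = trans (sym (weight-∁ ps B))
  (weight-vanishes-at-three-points ih ps ann (∁ B) (balanced-∁ B balanced) c≢b
    (∁-flips B b B-b) (∁-flips B a B-a) (∁-flips B c B-c))

weight₁₀-vanishes : WeightsVanish 0 → (ps : Combination 2) → Annihilates ps →
                    weight ps (true ∷ false ∷ []) ≡ 0ℚ
weight₁₀-vanishes ih ps ann = pairwise-sums-zero⇒zero w w w w+w≡0 w+w≡0 w+w≡0
  where
  w : ℚ
  w = weight ps (true ∷ false ∷ [])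
  w+w≡0 : w + w ≡ 0ℚ
  w+w≡0 = trans (cong (w +_) (sym (weight-∁ ps (true ∷ false ∷ []))))
                (exchange₀₁-weights-cancel ih ps ann [] refl)

weightsVanish-two : WeightsVanish 0 → WeightsVanish 2
weightsVanish-two ih ps ann (true  ∷ false ∷ []) _ = weight₁₀-vanishes ih ps ann
weightsVanish-two ih ps ann (false ∷ true  ∷ []) _ =
  trans (weight-∁ ps (true ∷ false ∷ [])) (weight₁₀-vanishes ih ps ann)
weightsVanish-two ih ps ann (true  ∷ true  ∷ []) ()
weightsVanish-two ih ps ann (false ∷ false ∷ []) ()

weightsVanish-zero : WeightsVanish 0
weightsVanish-zero ps ann [] _ = cong₂ _+_ coefficient≡0 coefficient≡0
  where
  ν₀ : Vertical 0
  ν₀ = (λ ()) , (λ ()) , (λ ())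
  entry : ∀ p → proj₂ p * 𝟙 (proj₁ p ≟ˢ []) ≡ proj₂ p * K (proj₁ p) ν₀
  entry ([] , c) = refl
  coefficient≡0 : coefficient ps [] ≡ 0ℚ
  coefficient≡0 = trans (∑-cong entry ps) (ann ν₀)

weightsVanish : (N : ℕ) → WeightsVanish N
weightsVanish zero                = weightsVanish-zero
weightsVanish (suc zero) ps ann (true  ∷ []) ()
weightsVanish (suc zero) ps ann (false ∷ []) ()
weightsVanish (suc (suc zero))    = weightsVanish-two weightsVanish-zero
weightsVanish (suc (suc (suc M))) = weightsVanish-step (weightsVanish (suc M))

module _ {N : ℕ} where

  weight-∷ : (A : Subset N) (c : ℚ) (qs : Combination N) (B : Subset N) →
             weight ((A , c) ∷ qs) B ≡ (c * 𝟙 (A ≟ˢ B) + c * 𝟙 (A ≟ˢ ∁ B)) + weight qs B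
  weight-∷ A c qs B =
    +-interchange (c * 𝟙 (A ≟ˢ B)) (coefficient qs B) (c * 𝟙 (A ≟ˢ ∁ B)) (coefficient qs (∁ B))

  weight-absent : (qs : Combination N) (A : Subset N) →
                  All (λ q → ¬ SameHorizontal A (proj₁ q)) qs → weight qs A ≡ 0ℚ
  weight-absent qs A absent = cong₂ _+_
    (∑-zero _ (All.map (λ {q} ¬same → entry≡0 q (¬same ∘ inj₁ ∘ sym)) absent))
    (∑-zero _ (All.map (λ {q} ¬same → entry≡0 q (¬same ∘ inj₂ ∘ ≡∁⇒∁≡)) absent))
    where
    entry≡0 : (q : Subset N × ℚ) {B : Subset N} → proj₁ q ≢ B → proj₂ q * 𝟙 (proj₁ q ≟ˢ B) ≡ 0ℚ
    entry≡0 q {B} q≢B = trans (cong (proj₂ q *_) (𝟙-no (proj₁ q ≟ˢ B) q≢B)) (ℚ.*-zeroʳ (proj₂ q))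
    ≡∁⇒∁≡ : {B : Subset N} → B ≡ ∁ A → A ≡ ∁ B
    ≡∁⇒∁≡ refl = sym (∁-involutive A)

≢∁ : {N : ℕ} (A : Subset (suc N)) → A ≢ ∁ A
≢∁ (true  ∷ A) ()
≢∁ (false ∷ A) ()

coefficients-vanish : {N : ℕ} (ps : Combination (suc N)) → All (Balanced ∘ proj₁) ps →
  AllPairs (λ p q → ¬ SameHorizontal (proj₁ p) (proj₁ q)) ps →
  (∀ B → Balanced B → weight ps B ≡ 0ℚ) → All (λ p → proj₂ p ≡ 0ℚ) ps
coefficients-vanish []             []                  []                    _         = []
coefficients-vanish {N} ((A , c) ∷ qs) (A-balanced ∷ rows) (A-absent ∷ distinct) weights≡0 =
  c≡0 ∷ coefficients-vanish qs rows distinct λ B balanced → trans (sym (drop-head B)) (weights≡0 B balanced)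
  where
  open ≡-Reasoning
  head-term : ℚ → Subset (suc N) → ℚ
  head-term c′ B = c′ * 𝟙 (A ≟ˢ B) + c′ * 𝟙 (A ≟ˢ ∁ B)
  c≡0 : c ≡ 0ℚ
  c≡0 = begin
    c
      ≡⟨ solve 1 (λ c → c := (c :* con 1ℚ :+ c :* con 0ℚ) :+ con 0ℚ) refl c ⟩
    (c * 1ℚ + c * 0ℚ) + 0ℚ
      ≡⟨ cong₂ (λ x y → (c * x + c * y) + 0ℚ) (𝟙-yes (A ≟ˢ A) refl) (𝟙-no (A ≟ˢ ∁ A) (≢∁ A)) ⟨
    head-term c A + 0ℚ
      ≡⟨ cong (head-term c A +_) (weight-absent qs A A-absent) ⟨
    head-term c A + weight qs A
      ≡⟨ weight-∷ A c qs A ⟨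
    weight ((A , c) ∷ qs) A
      ≡⟨ weights≡0 A A-balanced ⟩
    0ℚ ∎
    where open +-*-Solver
  drop-head : ∀ B → weight ((A , c) ∷ qs) B ≡ weight qs B
  drop-head B = begin
    weight ((A , c) ∷ qs) B
      ≡⟨ weight-∷ A c qs B ⟩
    head-term c B + weight qs B
      ≡⟨ cong (λ c′ → head-term c′ B + weight qs B) c≡0 ⟩
    head-term 0ℚ B + weight qs B
      ≡⟨ cong₂ (λ x y → x + y + weight qs B) (ℚ.*-zeroˡ (𝟙 (A ≟ˢ B))) (ℚ.*-zeroˡ (𝟙 (A ≟ˢ ∁ B))) ⟩
    (0ℚ + 0ℚ) + weight qs B
      ≡⟨ ℚ.+-identityˡ (weight qs B) ⟩
    weight qs B ∎

row-balanced : (n : ℕ) (A : Subset (2 ℕ.* n)) → IsRow n A → Balanced A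
row-balanced n A ∣A∣≡n = begin
  ∣ A ∣                  ≡⟨ ∣A∣≡n ⟩
  n                      ≡⟨ ℕ.+-identityʳ n ⟨
  n ℕ.+ 0                ≡⟨ ℕ.m+n∸m≡n n (n ℕ.+ 0) ⟨
  2 ℕ.* n ℕ.∸ n          ≡⟨ cong (2 ℕ.* n ℕ.∸_) ∣A∣≡n ⟨
  2 ℕ.* n ℕ.∸ ∣ A ∣      ≡⟨ ∣∁p∣≡n∸∣p∣ A ⟨
  ∣ ∁ A ∣                ∎
  where open ≡-Reasoning

theorem2p1 : (n : ℕ) → 1 ≤ n → RowsLinearlyIndependent n
theorem2p1 n@(suc _) _ ps rows distinct annihilates =
  coefficients-vanish ps (All.map (λ {p} → row-balanced n (proj₁ p)) rows) distinct
    (weightsVanish (2 ℕ.* n) ps annihilates)
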